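{- Let $\lambda_1,\lambda_2$ be hook-shaped partitions of $n$, $A\in\mathrm{SYT}(\lambda_1)$, $B\in\mathrm{SYT}(\lambda_2)$, and let $S_{A,B}$ be the set of $k\in\{1,\dots,n\}$ such that $k$ lies in the first row of $A$ and in the first row of $B$. Then $|S_{A,B}|$ is invariant under the diagonal action of $C_n$, i.e. $|S_{g(A),g(B)}|=|S_{A,B}|$ for all $g\in C_n$.
   Context: A partition is identified with its Young diagram (boxes $(i,j)$, row $i$, column $j$); it is hook-shaped if its diagram does not contain the box $(2,2)$. $\mathrm{SYT}(\lambda)$ is the set of standard Young tableaux of shape $\lambda$ (fillings by $1,\dots,n$ increasing along rows and down columns). The cactus group $C_n$ (generators $s_{[i,j]}$, $1\le i<j\le n$, relations $s_{[i,j]}^2=1$; $s_{[i,j]}s_{[k,l]}=s_{[k,l]}s_{[i,j]}$ for disjoint intervals; $s_{[i,j]}s_{[k,l]}s_{[i,j]}=s_{[i+j-l,i+j-k]}$ for $[k,l]\subseteq[i,j]$) acts on each $\mathrm{SYT}(\lambda)$, $\lambda\vdash n$, with $s_{[1,j]}$ acting as the Schützenberger involution of the subtableau of entries $1,\dots,j$; its image equals the group generated by the Bender–Knuth involutions $t_i$ ($t_i$ swaps $i$ and $i+1$ if the result is standard, else does nothing). -}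

module Defs where

open import Data.Nat using (ℕ; zero; suc; _+_; _<_; _≤_; _<ᵇ_; _≡ᵇ_)
open import Data.Nat.Properties using (_≟_)
open import Data.Bool using (Bool; true; false; _∧_; if_then_else_)
open import Data.List using (List; []; _∷_; map; length; filter; concat; upTo)
open import Data.Nat.ListAction using (sum)
open import Data.Bool.ListAction using (all)
open import Data.List.Membership.DecPropositional _≟_ using (_∈?_)
open import Data.Product using (_×_; _,_)
open import Relation.Binary.PropositionalEquality using (_≡_)
open import Relation.Nullary.Decidable using (⌊_⌋; _×-dec_)

-- A (Young) tableau is
-- a list of rows T = [row₁, row₂, …] (row i is the list of entries in
-- boxes (i,1),(i,2),…).

oneTo : ℕ → List ℕ
oneTo n = map suc (upTo n)

isPartitionᵇ : List ℕ → Bool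
isPartitionᵇ [] = true
isPartitionᵇ (a ∷ []) = 0 <ᵇ a
isPartitionᵇ (a ∷ b ∷ l) = (0 <ᵇ a) ∧ ((b <ᵇ a) ∨ᵇ (b ≡ᵇ a)) ∧ isPartitionᵇ (b ∷ l)
  where
  _∨ᵇ_ : Bool → Bool → Bool
  true ∨ᵇ _ = true
  false ∨ᵇ y = y

IsPartitionOf : ℕ → List ℕ → Set
IsPartitionOf n la = (isPartitionᵇ la ≡ true) × (sum la ≡ n)

part₂ : List ℕ → ℕ
part₂ (_ ∷ b ∷ _) = b
part₂ _ = 0

-- hook-shaped: the diagram does not contain the box (2,2), i.e. λ₂ < 2
IsHook : List ℕ → Set
IsHook la = part₂ la < 2

shape : List (List ℕ) → List ℕ
shape T = map length T

rowIncᵇ : List ℕ → Bool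
rowIncᵇ [] = true
rowIncᵇ (a ∷ []) = true
rowIncᵇ (a ∷ b ∷ l) = (a <ᵇ b) ∧ rowIncᵇ (b ∷ l)

colIncPairᵇ : List ℕ → List ℕ → Bool
colIncPairᵇ (a ∷ r) (b ∷ s) = (a <ᵇ b) ∧ colIncPairᵇ r s
colIncPairᵇ _ _ = true

colIncᵇ : List (List ℕ) → Bool
colIncᵇ (r ∷ s ∷ T) = colIncPairᵇ r s ∧ colIncᵇ (s ∷ T)
colIncᵇ _ = true

isIncreasingᵇ : List (List ℕ) → Bool
isIncreasingᵇ T = all rowIncᵇ T ∧ colIncᵇ T

IsSYT : ℕ → List ℕ → List (List ℕ) → Set
IsSYT n la T =
  IsPartitionOf n la × (shape T ≡ la)
  × (length (concat T) ≡ n)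
  × (all (λ k → ⌊ length (filter (λ x → x ≟ k) (concat T)) ≟ 1 ⌋) (oneTo n) ≡ true)
  × (isIncreasingᵇ T ≡ true)

swapEntry : ℕ → ℕ → ℕ
swapEntry i x = if x ≡ᵇ i then suc i else (if x ≡ᵇ suc i then i else x)

bk : ℕ → List (List ℕ) → List (List ℕ)
bk i T = let S = map (map (swapEntry i)) T in
         if isIncreasingᵇ S then S else T

bkDown : ℕ → List (List ℕ) → List (List ℕ)
bkDown zero T = T
bkDown (suc m) T = bk (suc m) (bkDown m T)

-- q_j = t_1 (t_2 t_1) ⋯ (t_{j-1} ⋯ t_1): the Schützenberger involution
-- (evacuation) of the subtableau with entries 1,…,j
-- (Berenstein–Kirillov's expression of evacuation via Bender–Knuth moves)
evac : ℕ → List (List ℕ) → List (List ℕ)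
evac zero T = T
evac (suc zero) T = T
evac (suc (suc m)) T = evac (suc m) (bkDown (suc m) T)

-- the generator s_[i,j] of C_n acts by q_j q_{j-i+1} q_j
-- (s_[i,j] = s_[1,j] s_[1,j-i+1] s_[1,j] in C_n)
sAct : ℕ → ℕ → List (List ℕ) → List (List ℕ)
sAct i j T = evac j (evac (suc (j Data.Nat.∸ i)) (evac j T))

-- an element of C_n, given as a word in the generators s_[i,j]
-- (every element is such a word since the generators are involutions)
ValidWord : ℕ → List (ℕ × ℕ) → Set
ValidWord n w = all (λ { (i , j) → (0 <ᵇ i) ∧ (i <ᵇ j) ∧ ((j <ᵇ n) ∨' (j ≡ᵇ n)) }) w ≡ true
  where
  _∨'_ : Bool → Bool → Bool
  true ∨' _ = true
  false ∨' y = y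

act : List (ℕ × ℕ) → List (List ℕ) → List (List ℕ)
act [] T = T
act ((i , j) ∷ w) T = sAct i j (act w T)

firstRow : List (List ℕ) → List ℕ
firstRow [] = []
firstRow (r ∷ _) = r

S : ℕ → List (List ℕ) → List (List ℕ) → List ℕ
S n A B = filter (λ k → k ∈? firstRow A ×-dec k ∈? firstRow B) (oneTo n)

{-# OPTIONS --safe #-}
module Submission where

-- A hook tableau is determined by its corner 1, its arm (the rest of the first row) and its
-- leg (the rest of the first column).  On hooks, t₁ is the identity, since 2 sits next to the
-- corner.  For i ≥ 2, t_i swaps i and i+1 when they lie in different arms and is trivial
-- otherwise; in every case the first-row set is relabelled by the transposition (i i+1).  So
-- each Bender–Knuth move, hence each element g of C_n, relabels the first rows of all hook
-- tableaux of size n by one and the same permutation π of {1,…,n}.  Then S_{gA,gB} = π⁻¹(S_{A,B}),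
-- which has the same number of elements.

open import Defs
open import Data.Bool using (Bool; true; false; T; _∧_; if_then_else_)
open import Data.Bool.ListAction using (all)
open import Data.Bool.Properties using (∧-identityʳ; ∧-zeroʳ)
open import Data.Empty using (⊥-elim)
open import Data.List using (List; []; _∷_; [_]; _++_; map; length; filter; concat; upTo)
open import Data.List.Membership.Propositional using (_∈_; _∉_)
open import Data.List.Membership.Propositional.Properties
  using (∈-map⁺; ∈-map⁻; ∈-upTo⁺; ∈-++⁺ˡ; ∈-++⁺ʳ; ∈-++⁻; ∈-∃++)
open import Data.List.Properties
  using (map-∘; map-++; upTo-∷ʳ; filter-++; filter-some; filter-reject; length-++; length-++-sucʳ; concat-map-[_])
open import Data.List.Relation.Unary.All as All using ()
open import Data.List.Relation.Unary.All.Properties using (all⁺)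
open import Data.List.Relation.Unary.AllPairs using (_∷_)
open import Data.List.Relation.Unary.Any as Any using (here; there)
open import Data.List.Relation.Unary.Linked as Linked using (Linked; []; [-]; _∷_; linked?)
open import Data.List.Relation.Unary.Linked.Properties using (Linked⇒AllPairs)
open import Data.Nat using (ℕ; zero; suc; _+_; _∸_; _<_; _≤_; _≡ᵇ_; _<ᵇ_; z≤n; s≤s)
open import Data.Nat.ListAction using (sum)
open import Data.Nat.Properties
open import Data.List.Membership.DecPropositional _≟_ using (_∈?_)
open import Data.Product using (_×_; _,_; proj₂; ∃-syntax)
open import Data.Product.Function.NonDependent.Propositional using (_×-⇔_)
open import Data.Sum as Sum using (_⊎_; inj₁; inj₂)
open import Function using (_∘_; id; const; _⇔_; mk⇔; Equivalence)
open import Function.Construct.Composition using (_⇔-∘_)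
open import Function.Construct.Identity using (⇔-id)
open import Function.Construct.Symmetry using (⇔-sym)
open import Level using (0ℓ)
open import Relation.Binary.PropositionalEquality hiding ([_])
open import Relation.Nullary using (Dec; ¬_; yes; no; does; proof; contradiction)
open import Relation.Nullary.Decidable using (_×-dec_; dec-true; dec-false; does-⇔; ⌊_⌋; toWitness)
open import Relation.Nullary.Reflects using (Reflects; invert)
open import Relation.Unary using (Pred; Decidable)

private
  variable
    a i j k m n x y : ℕ
    xs ys arm leg : List ℕ

≡true⇒T : ∀ {b} → b ≡ true → T b
≡true⇒T refl = _

∧-≡true-proj₁ : ∀ {a b} → a ∧ b ≡ true → a ≡ true
∧-≡true-proj₁ {true} _ = refl

∧-≡true-proj₂ : ∀ {a b} → a ∧ b ≡ true → b ≡ true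
∧-≡true-proj₂ {true} b≡true = b≡true

-- does (m ≟ n) is definitionally m ≡ᵇ n.
≡ᵇ-refl : ∀ n → (n ≡ᵇ n) ≡ true
≡ᵇ-refl n = dec-true (n ≟ n) refl

≡ᵇ-false : m ≢ n → (m ≡ᵇ n) ≡ false
≡ᵇ-false {m} {n} = dec-false (m ≟ n)

swapEntry-left : ∀ i → swapEntry i i ≡ suc i
swapEntry-left i rewrite ≡ᵇ-refl i = refl

swapEntry-right : ∀ i → swapEntry i (suc i) ≡ i
swapEntry-right i rewrite ≡ᵇ-false (1+n≢n {i}) | ≡ᵇ-refl i = refl

swapEntry-other : x ≢ i → x ≢ suc i → swapEntry i x ≡ x
swapEntry-other x≢i x≢1+i rewrite ≡ᵇ-false x≢i | ≡ᵇ-false x≢1+i = refl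

swapEntry-involutive : ∀ i x → swapEntry i (swapEntry i x) ≡ x
swapEntry-involutive i x with x ≟ i | x ≟ suc i
... | yes refl | _ = trans (cong (swapEntry x) (swapEntry-left x)) (swapEntry-right x)
... | no _ | yes refl = trans (cong (swapEntry i) (swapEntry-right i)) (swapEntry-left i)
... | no x≢i | no x≢1+i = trans (cong (swapEntry i) (swapEntry-other x≢i x≢1+i)) (swapEntry-other x≢i x≢1+i)

∈-map-swapEntry : k ∈ map (swapEntry i) xs ⇔ swapEntry i k ∈ xs
∈-map-swapEntry {k} {i} {xs} = mk⇔ to from
  where
  to : k ∈ map (swapEntry i) xs → swapEntry i k ∈ xs
  to k∈ with y , y∈xs , refl ← ∈-map⁻ (swapEntry i) k∈ = subst (_∈ xs) (sym (swapEntry-involutive i y)) y∈xs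
  from : swapEntry i k ∈ xs → k ∈ map (swapEntry i) xs
  from σk∈xs = subst (_∈ map (swapEntry i) xs) (swapEntry-involutive i k) (∈-map⁺ (swapEntry i) σk∈xs)

swapEntry-< : x < y → ¬ (x ≡ i × y ≡ suc i) → swapEntry i x < swapEntry i y
swapEntry-< {x} {y} {i} x<y not-pair with y ≟ i | y ≟ suc i
... | yes refl | _
  rewrite swapEntry-left y | swapEntry-other (<⇒≢ x<y) (<⇒≢ (m<n⇒m<1+n x<y)) = m<n⇒m<1+n x<y
... | no _ | yes refl
  rewrite swapEntry-right i | swapEntry-other (not-pair ∘ (_, refl)) (<⇒≢ x<y)
  = ≤∧≢⇒< (≤-pred x<y) (not-pair ∘ (_, refl))
... | no y≢i | no y≢1+i rewrite swapEntry-other y≢i y≢1+i with x ≟ i | x ≟ suc i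
...   | yes refl | _ rewrite swapEntry-left x = ≤∧≢⇒< x<y (y≢1+i ∘ sym)
...   | no _ | yes refl rewrite swapEntry-right i = <-trans (n<1+n i) x<y
...   | no x≢i | no x≢1+i rewrite swapEntry-other x≢i x≢1+i = x<y

∈-swapEntry-invariant : (i ∈ xs ⇔ suc i ∈ xs) → ∀ k → k ∈ xs ⇔ swapEntry i k ∈ xs
∈-swapEntry-invariant {i} i⇔1+i k with k ≟ i | k ≟ suc i
... | yes refl | _ rewrite swapEntry-left k = i⇔1+i
... | no _ | yes refl rewrite swapEntry-right i = ⇔-sym i⇔1+i
... | no k≢i | no k≢1+i rewrite swapEntry-other k≢i k≢1+i = ⇔-id _

swapEntry-range : 1 ≤ i → i < n → 1 ≤ k → k ≤ n → 1 ≤ swapEntry i k × swapEntry i k ≤ n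
swapEntry-range {i} {n} {k} 1≤i i<n 1≤k k≤n with k ≟ i | k ≟ suc i
... | yes refl | _ rewrite swapEntry-left k = s≤s z≤n , i<n
... | no _ | yes refl rewrite swapEntry-right i = 1≤i , <⇒≤ i<n
... | no k≢i | no k≢1+i rewrite swapEntry-other k≢i k≢1+i = 1≤k , k≤n

count : (ℕ → Bool) → ℕ → ℕ
count p zero = 0
count p (suc n) = if p (suc n) then suc (count p n) else count p n

count-cong : ∀ {p q : ℕ → Bool} n → (∀ {k} → k ≤ n → p k ≡ q k) → count p n ≡ count q n
count-cong zero _ = refl
count-cong (suc n) p≗q rewrite p≗q ≤-refl | count-cong n (p≗q ∘ m≤n⇒m≤1+n) = refl

count-swapEntry : 1 ≤ i → i < n → ∀ p → count (p ∘ swapEntry i) n ≡ count p n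
count-swapEntry {i} {suc m} 1≤i i<1+m p with m≤n⇒m<n∨m≡n (≤-pred i<1+m)
... | inj₁ i<m
  rewrite swapEntry-other {suc m} {i} (>⇒≢ (m<n⇒m<1+n i<m)) (>⇒≢ (s≤s i<m)) | count-swapEntry 1≤i i<m p = refl
count-swapEntry {suc i} 1≤i _ p | inj₂ refl
  rewrite swapEntry-right (suc i) | swapEntry-left (suc i)
        | count-cong {p ∘ swapEntry (suc i)} {p} i
            (λ k≤i → cong p (swapEntry-other (<⇒≢ (s≤s k≤i)) (<⇒≢ (m<n⇒m<1+n (s≤s k≤i)))))
  with p (suc i) | p (suc (suc i))
... | true | true = refl
... | true | false = refl
... | false | true = refl
... | false | false = refl

oneTo-suc : ∀ n → oneTo (suc n) ≡ oneTo n ++ [ suc n ]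
oneTo-suc n = trans (cong (map suc) (sym (upTo-∷ʳ n))) (map-++ suc (upTo n) [ n ])

length-filter-∷ʳ : ∀ {P : Pred ℕ 0ℓ} (P? : Decidable P) xs x →
  length (filter P? (xs ++ [ x ])) ≡ (if does (P? x) then suc (length (filter P? xs)) else length (filter P? xs))
length-filter-∷ʳ P? xs x rewrite filter-++ P? xs [ x ] | length-++ (filter P? xs) {filter P? [ x ]}
  with does (P? x)
... | true = +-comm _ 1
... | false = +-identityʳ _

length-filter-oneTo : ∀ {P : Pred ℕ 0ℓ} (P? : Decidable P) n →
  length (filter P? (oneTo n)) ≡ count (λ k → does (P? k)) n
length-filter-oneTo P? zero = refl
length-filter-oneTo P? (suc n) = begin
  length (filter P? (oneTo (suc n)))       ≡⟨ cong (length ∘ filter P?) (oneTo-suc n) ⟩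
  length (filter P? (oneTo n ++ [ suc n ])) ≡⟨ length-filter-∷ʳ P? (oneTo n) (suc n) ⟩
  (if does (P? (suc n)) then suc (length (filter P? (oneTo n))) else length (filter P? (oneTo n)))
    ≡⟨ cong (λ c → if does (P? (suc n)) then suc c else c) (length-filter-oneTo P? n) ⟩
  count (λ k → does (P? k)) (suc n)         ∎
  where open ≡-Reasoning

Increasing : List ℕ → Set
Increasing = Linked _<_

rowIncᵇ-does : ∀ xs → rowIncᵇ xs ≡ does (linked? _<?_ xs)
rowIncᵇ-does [] = refl
rowIncᵇ-does (x ∷ []) = refl
rowIncᵇ-does (x ∷ y ∷ xs) = cong ((x <ᵇ y) ∧_) (rowIncᵇ-does (y ∷ xs))

rowIncᵇ-true : Increasing xs → rowIncᵇ xs ≡ true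
rowIncᵇ-true {xs} xs↑ = trans (rowIncᵇ-does xs) (dec-true (linked? _<?_ xs) xs↑)

rowIncᵇ-false : ¬ Increasing xs → rowIncᵇ xs ≡ false
rowIncᵇ-false {xs} xs↑̸ = trans (rowIncᵇ-does xs) (dec-false (linked? _<?_ xs) xs↑̸)

rowIncᵇ-sound : rowIncᵇ xs ≡ true → Increasing xs
rowIncᵇ-sound {xs} e =
  invert (subst (Reflects (Increasing xs)) (trans (sym (rowIncᵇ-does xs)) e) (proof (linked? _<?_ xs)))

head<tail : Increasing (a ∷ xs) → x ∈ xs → a < x
head<tail a∷xs↑ x∈xs with a<xs ∷ _ ← Linked⇒AllPairs <-trans a∷xs↑ = All.lookup a<xs x∈xs

head≤ : Increasing (a ∷ xs) → x ∈ a ∷ xs → a ≤ x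
head≤ _ (here refl) = ≤-refl
head≤ a∷xs↑ (there x∈xs) = <⇒≤ (head<tail a∷xs↑ x∈xs)

swapEntry-breaks-Increasing : Increasing xs → i ∈ xs → suc i ∈ xs → ¬ Increasing (map (swapEntry i) xs)
swapEntry-breaks-Increasing _ (here refl) (here 1+i≡i) = contradiction 1+i≡i 1+n≢n
swapEntry-breaks-Increasing {y ∷ _} {i} (i<y ∷ y∷xs↑) (here refl) (there 1+i∈y∷xs)
  with refl ← ≤-antisym (head≤ y∷xs↑ 1+i∈y∷xs) i<y
  = λ { (σi<σ1+i ∷ _) → <-asym (n<1+n i) (subst₂ _<_ (swapEntry-left i) (swapEntry-right i) σi<σ1+i) }
swapEntry-breaks-Increasing xs↑ (there i∈xs) (here refl) = contradiction (head<tail xs↑ i∈xs) (<-asym (n<1+n _))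
swapEntry-breaks-Increasing xs↑ (there i∈xs) (there 1+i∈xs) =
  swapEntry-breaks-Increasing (Linked.tail xs↑) i∈xs 1+i∈xs ∘ Linked.tail

swapEntry-preserves-Increasing : Increasing xs → ¬ (i ∈ xs × suc i ∈ xs) → Increasing (map (swapEntry i) xs)
swapEntry-preserves-Increasing [] _ = []
swapEntry-preserves-Increasing [-] _ = [-]
swapEntry-preserves-Increasing (x<y ∷ ys↑) not-both =
  swapEntry-< x<y (λ { (refl , refl) → not-both (here refl , there (here refl)) })
  ∷ swapEntry-preserves-Increasing ys↑ (λ (i∈ , 1+i∈) → not-both (there i∈ , there 1+i∈))

hook : ℕ → List ℕ → List ℕ → List (List ℕ)
hook a arm leg = (a ∷ arm) ∷ map [_] leg

map-hook : ∀ (f : ℕ → ℕ) a arm leg → map (map f) (hook a arm leg) ≡ hook (f a) (map f arm) (map f leg)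
map-hook f a arm leg = cong ((f a ∷ map f arm) ∷_) (trans (sym (map-∘ leg)) (map-∘ leg))

colIncPairᵇ-[] : ∀ xs → colIncPairᵇ xs [] ≡ true
colIncPairᵇ-[] [] = refl
colIncPairᵇ-[] (_ ∷ _) = refl

colIncᵇ-hook : ∀ a arm leg → colIncᵇ (hook a arm leg) ≡ rowIncᵇ (a ∷ leg)
colIncᵇ-hook a arm [] = refl
colIncᵇ-hook a arm (b ∷ leg) rewrite colIncPairᵇ-[] arm | ∧-identityʳ (a <ᵇ b) =
  cong ((a <ᵇ b) ∧_) (colIncᵇ-hook b [] leg)

all-rowIncᵇ-column : ∀ leg → all rowIncᵇ (map [_] leg) ≡ true
all-rowIncᵇ-column [] = refl
all-rowIncᵇ-column (_ ∷ leg) = all-rowIncᵇ-column leg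

isIncreasingᵇ-hook : ∀ a arm leg → isIncreasingᵇ (hook a arm leg) ≡ rowIncᵇ (a ∷ arm) ∧ rowIncᵇ (a ∷ leg)
isIncreasingᵇ-hook a arm leg rewrite all-rowIncᵇ-column leg | ∧-identityʳ (rowIncᵇ (a ∷ arm)) =
  cong (rowIncᵇ (a ∷ arm) ∧_) (colIncᵇ-hook a arm leg)

bk-hook : ∀ i a arm leg → let σ = swapEntry i in
  bk i (hook a arm leg)
    ≡ (if rowIncᵇ (map σ (a ∷ arm)) ∧ rowIncᵇ (map σ (a ∷ leg))
       then hook (σ a) (map σ arm) (map σ leg) else hook a arm leg)
bk-hook i a arm leg =
  trans (cong (λ S → if isIncreasingᵇ S then S else hook a arm leg) (map-hook σ a arm leg))
        (cong (λ b → if b then hook (σ a) (map σ arm) (map σ leg) else hook a arm leg)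
              (isIncreasingᵇ-hook (σ a) (map σ arm) (map σ leg)))
  where σ = swapEntry i

bk-hook-fixed : ¬ Increasing (map (swapEntry i) (a ∷ arm)) ⊎ ¬ Increasing (map (swapEntry i) (a ∷ leg))
  → bk i (hook a arm leg) ≡ hook a arm leg
bk-hook-fixed {i} {a} {arm} {leg} (inj₁ arm↑̸) rewrite bk-hook i a arm leg | rowIncᵇ-false arm↑̸ = refl
bk-hook-fixed {i} {a} {arm} {leg} (inj₂ leg↑̸)
  rewrite bk-hook i a arm leg | rowIncᵇ-false leg↑̸ | ∧-zeroʳ (rowIncᵇ (map (swapEntry i) (a ∷ arm))) = refl

bk-hook-swapped : Increasing (map (swapEntry i) (a ∷ arm)) → Increasing (map (swapEntry i) (a ∷ leg))
  → bk i (hook a arm leg) ≡ hook (swapEntry i a) (map (swapEntry i) arm) (map (swapEntry i) leg)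
bk-hook-swapped {i} {a} {arm} {leg} arm↑ leg↑
  rewrite bk-hook i a arm leg | rowIncᵇ-true arm↑ | rowIncᵇ-true leg↑ = refl

record IsHookSYT (n : ℕ) (arm leg : List ℕ) : Set where
  field
    arm↑ : Increasing (1 ∷ arm)
    leg↑ : Increasing (1 ∷ leg)
    covers : ∀ {k} → 1 ≤ k → k ≤ n → k ∈ 1 ∷ arm ⊎ k ∈ leg
    disjoint : ∀ {k} → 1 ≤ k → k ≤ n → k ∈ arm → k ∉ leg

data HookSYT (n : ℕ) : List (List ℕ) → Set where
  hookSYT : IsHookSYT n arm leg → HookSYT n (hook 1 arm leg)

FirstRowRelabelled : (ℕ → ℕ) → List (List ℕ) → List (List ℕ) → Set
FirstRowRelabelled π t t′ = ∀ k → k ∈ firstRow t′ ⇔ π k ∈ firstRow t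

bk-1-fixes : ∀ {t} → 1 < n → HookSYT n t → bk 1 t ≡ t
bk-1-fixes 1<n (hookSYT h) = bk-hook-fixed
  (Sum.map (swapEntry-breaks-Increasing arm↑ (here refl)) (swapEntry-breaks-Increasing leg↑ (here refl) ∘ there)
           (covers (s≤s z≤n) 1<n))
  where open IsHookSYT h

swapEntry-IsHookSYT : ∀ {j} → let σ = swapEntry (2 + j) in
  2 + j < n → IsHookSYT n arm leg
  → ¬ (2 + j ∈ 1 ∷ arm × 3 + j ∈ 1 ∷ arm) → ¬ (2 + j ∈ 1 ∷ leg × 3 + j ∈ 1 ∷ leg)
  → IsHookSYT n (map σ arm) (map σ leg)
swapEntry-IsHookSYT {n} {arm} {leg} {j} i<n h arm-split leg-split = record
  { arm↑ = swapEntry-preserves-Increasing arm↑ arm-split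
  ; leg↑ = swapEntry-preserves-Increasing leg↑ leg-split
  ; covers = λ 1≤k k≤n → Sum.map (from ∈-map-swapEntry) (from ∈-map-swapEntry) (on-range covers 1≤k k≤n)
  ; disjoint = λ 1≤k k≤n k∈arm → on-range disjoint 1≤k k≤n (to ∈-map-swapEntry k∈arm) ∘ to ∈-map-swapEntry
  }
  where
  open IsHookSYT h
  open Equivalence
  σ = swapEntry (2 + j)
  on-range : ∀ {P : ℕ → Set} → (∀ {k} → 1 ≤ k → k ≤ n → P k) → ∀ {k} → 1 ≤ k → k ≤ n → P (σ k)
  on-range p 1≤k k≤n with 1≤σk , σk≤n ← swapEntry-range (s≤s z≤n) i<n 1≤k k≤n = p 1≤σk σk≤n

Relabels : ℕ → (ℕ → ℕ) → List (List ℕ) → List (List ℕ) → Set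
Relabels n π t t′ = HookSYT n t′ × FirstRowRelabelled π t t′

module _ {n j arm leg} (i<n : 2 + j < n) (h : IsHookSYT n arm leg) where
  open IsHookSYT h

  private
    σ = swapEntry (2 + j)
    t = hook 1 arm leg

  bk-hook-relabels : Relabels n σ t (bk (2 + j) t)
  bk-hook-relabels with 2 + j ∈? 1 ∷ arm ×-dec 3 + j ∈? 1 ∷ arm | 2 + j ∈? 1 ∷ leg ×-dec 3 + j ∈? 1 ∷ leg
  ... | yes (i∈arm , 1+i∈arm) | _ =
    subst (Relabels n σ t) (sym (bk-hook-fixed (inj₁ (swapEntry-breaks-Increasing arm↑ i∈arm 1+i∈arm))))
      (hookSYT h , ∈-swapEntry-invariant (mk⇔ (const 1+i∈arm) (const i∈arm)))
  ... | no _ | yes (here () , _)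
  ... | no _ | yes (there _ , here ())
  ... | no _ | yes (there i∈leg , there 1+i∈leg) =
    subst (Relabels n σ t)
      (sym (bk-hook-fixed (inj₂ (swapEntry-breaks-Increasing leg↑ (there i∈leg) (there 1+i∈leg)))))
      (hookSYT h , ∈-swapEntry-invariant (mk⇔ (⊥-elim ∘ i∉arm) (⊥-elim ∘ 1+i∉arm)))
    where
    i∉arm : 2 + j ∉ 1 ∷ arm
    i∉arm (there i∈arm) = disjoint (s≤s z≤n) (<⇒≤ i<n) i∈arm i∈leg
    1+i∉arm : 3 + j ∉ 1 ∷ arm
    1+i∉arm (there 1+i∈arm) = disjoint (s≤s z≤n) i<n 1+i∈arm 1+i∈leg
  ... | no arm-split | no leg-split =
    subst (Relabels n σ t)
      (sym (bk-hook-swapped (swapEntry-preserves-Increasing arm↑ arm-split)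
                            (swapEntry-preserves-Increasing leg↑ leg-split)))
      (hookSYT (swapEntry-IsHookSYT i<n h arm-split leg-split) , λ _ → ∈-map-swapEntry)

CountInvariant : ℕ → (ℕ → ℕ) → Set
CountInvariant n π = ∀ p → count (p ∘ π) n ≡ count p n

length-S-relabelled : ∀ {π A A′ B B′} → CountInvariant n π
  → FirstRowRelabelled π A A′ → FirstRowRelabelled π B B′ → length (S n A′ B′) ≡ length (S n A B)
length-S-relabelled {n} {π} {A} {A′} {B} {B′} count-π A~A′ B~B′ = begin
  length (S n A′ B′)           ≡⟨ length-filter-oneTo (inBoth? A′ B′) n ⟩
  count (inBoth A′ B′) n       ≡⟨ count-cong n (λ {k} _ →
                                    does-⇔ (A~A′ k ×-⇔ B~B′ k) (inBoth? A′ B′ k) (inBoth? A B (π k))) ⟩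
  count (inBoth A B ∘ π) n     ≡⟨ count-π (inBoth A B) ⟩
  count (inBoth A B) n         ≡⟨ length-filter-oneTo (inBoth? A B) n ⟨
  length (S n A B)             ∎
  where
  open ≡-Reasoning
  inBoth? : ∀ X Y k → Dec (k ∈ firstRow X × k ∈ firstRow Y)
  inBoth? X Y k = k ∈? firstRow X ×-dec k ∈? firstRow Y
  inBoth : List (List ℕ) → List (List ℕ) → ℕ → Bool
  inBoth X Y k = does (inBoth? X Y k)

record PermutesFirstRows (n : ℕ) (F : List (List ℕ) → List (List ℕ)) : Set where
  field
    π : ℕ → ℕ
    count-π : CountInvariant n π
    relabels : ∀ {t} → HookSYT n t → Relabels n π t (F t)

id-permutes : PermutesFirstRows n id
id-permutes = record { π = id ; count-π = λ _ → refl ; relabels = λ h → h , λ _ → ⇔-id _ }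

∘-permutes : ∀ {F G} → PermutesFirstRows n F → PermutesFirstRows n G → PermutesFirstRows n (F ∘ G)
∘-permutes {n} {F} {G} pF pG = record
  { π = P.π pG ∘ P.π pF
  ; count-π = λ p → trans (P.count-π pF (p ∘ P.π pG)) (P.count-π pG p)
  ; relabels = λ hₜ → let (h-Gt , Gt~t) = P.relabels pG hₜ ; (h-FGt , FGt~Gt) = P.relabels pF h-Gt in
      h-FGt , λ k → Gt~t (P.π pF k) ⇔-∘ FGt~Gt k
  }
  where module P = PermutesFirstRows

bk-permutes : 1 ≤ i → i < n → PermutesFirstRows n (bk i)
bk-permutes {1} {n} _ 1<n = record
  { π = id ; count-π = λ _ → refl
  ; relabels = λ {t} h → subst (Relabels n id t) (sym (bk-1-fixes 1<n h)) (h , λ _ → ⇔-id _) }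
bk-permutes {suc (suc j)} 1≤i i<n = record
  { π = swapEntry (2 + j) ; count-π = count-swapEntry 1≤i i<n
  ; relabels = λ { (hookSYT h) → bk-hook-relabels i<n h } }

bkDown-permutes : ∀ m → m < n → PermutesFirstRows n (bkDown m)
bkDown-permutes zero _ = id-permutes
bkDown-permutes (suc m) m<n = ∘-permutes (bk-permutes (s≤s z≤n) m<n) (bkDown-permutes m (<-trans (n<1+n m) m<n))

evac-permutes : ∀ m → m ≤ n → PermutesFirstRows n (evac m)
evac-permutes zero _ = id-permutes
evac-permutes (suc zero) _ = id-permutes
evac-permutes (suc (suc m)) m≤n = ∘-permutes (evac-permutes (suc m) (<⇒≤ m≤n)) (bkDown-permutes (suc m) m≤n)

sAct-permutes : 0 < i → i < j → j ≤ n → PermutesFirstRows n (sAct i j)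
sAct-permutes {i} {j} 0<i i<j j≤n =
  ∘-permutes (evac-permutes j j≤n) (∘-permutes (evac-permutes (suc (j ∸ i)) 1+j-i≤n) (evac-permutes j j≤n))
  where 1+j-i≤n = ≤-trans (∸-monoʳ-< 0<i (<⇒≤ i<j)) j≤n

valid-cons : ∀ {w} → ValidWord n ((i , j) ∷ w) → 0 < i × i < j × j ≤ n × ValidWord n w
-- In the omitted cases v : false ≡ true.
valid-cons {n} {i} {j} v with 0 <ᵇ i in 0<i | i <ᵇ j in i<j | j <ᵇ n in j<n | j ≡ᵇ n in j≡n
... | true | true | true | _ = <ᵇ⇒< 0 i (≡true⇒T 0<i) , <ᵇ⇒< i j (≡true⇒T i<j) , <⇒≤ (<ᵇ⇒< j n (≡true⇒T j<n)) , v
... | true | true | false | true =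
  <ᵇ⇒< 0 i (≡true⇒T 0<i) , <ᵇ⇒< i j (≡true⇒T i<j) , ≤-reflexive (≡ᵇ⇒≡ j n (≡true⇒T j≡n)) , v

act-permutes : ∀ w → ValidWord n w → PermutesFirstRows n (act w)
act-permutes [] _ = id-permutes
act-permutes ((i , j) ∷ w) v with 0<i , i<j , j≤n , v′ ← valid-cons {i = i} {j = j} {w = w} v =
  ∘-permutes (sAct-permutes 0<i i<j j≤n) (act-permutes w v′)

OccursOnce : ℕ → List ℕ → Set
OccursOnce n es = all (λ k → ⌊ length (filter (λ x → x ≟ k) es) ≟ 1 ⌋) (oneTo n) ≡ true

∈-oneTo : 1 ≤ k → k ≤ n → k ∈ oneTo n
∈-oneTo {suc k} _ k<n = ∈-map⁺ suc (∈-upTo⁺ k<n)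

occurs-once : ∀ {es} → OccursOnce n es → 1 ≤ k → k ≤ n → length (filter (_≟ k) es) ≡ 1
occurs-once {n} {es} once 1≤k k≤n = toWitness (All.lookup (all⁺ _ (oneTo n) (≡true⇒T once)) (∈-oneTo 1≤k k≤n))

occurs⇒∈ : ∀ xs → 0 < length (filter (_≟ k) xs) → k ∈ xs
occurs⇒∈ {k} (x ∷ xs) occurs with x ≟ k
... | yes refl = here refl
... | no x≢k = there (occurs⇒∈ xs (subst (λ l → 0 < length l) (filter-reject (_≟ k) x≢k) occurs))

∈-both⇒occurs-twice : k ∈ xs → k ∈ ys → 2 ≤ length (filter (_≟ k) (xs ++ ys))
∈-both⇒occurs-twice {k} {xs} {ys} k∈xs k∈ys
  rewrite filter-++ (_≟ k) xs ys | length-++ (filter (_≟ k) xs) {filter (_≟ k) ys} =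
  +-mono-≤ (filter-some (_≟ k) (Any.map sym k∈xs)) (filter-some (_≟ k) (Any.map sym k∈ys))

contains-upTo⇒<length : ∀ n → (∀ {k} → k ≤ n → k ∈ xs) → n < length xs
contains-upTo⇒<length {[]} zero contains with () ← contains z≤n
contains-upTo⇒<length {_ ∷ _} zero _ = s≤s z≤n
contains-upTo⇒<length (suc n) contains with ys , zs , refl ← ∈-∃++ (contains ≤-refl) =
  subst (suc n <_) (sym (length-++-sucʳ ys (suc n) zs)) (s≤s (contains-upTo⇒<length n contains′))
  where
  contains′ : ∀ {k} → k ≤ n → k ∈ ys ++ zs
  contains′ k≤n with ∈-++⁻ ys (contains (m≤n⇒m≤1+n k≤n))
  ... | inj₁ k∈ys = ∈-++⁺ˡ k∈ys
  ... | inj₂ (here refl) = contradiction k≤n (<-irrefl refl)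
  ... | inj₂ (there k∈zs) = ∈-++⁺ʳ ys k∈zs

-- The disjunction inside isPartitionᵇ is local to Defs; case analysis on b <ᵇ a unblocks it.
isPartitionᵇ-tail : ∀ {a b l} → isPartitionᵇ (a ∷ b ∷ l) ≡ true → isPartitionᵇ (b ∷ l) ≡ true
isPartitionᵇ-tail {zero} ()
isPartitionᵇ-tail {suc a} {b} partition with b <ᵇ suc a
... | true = partition
... | false = ∧-≡true-proj₂ {b ≡ᵇ suc a} partition

column-of-ones : ∀ (rows : List (List ℕ)) → isPartitionᵇ (1 ∷ map length rows) ≡ true
  → ∃[ leg ] rows ≡ map [_] leg
column-of-ones [] _ = [] , refl
column-of-ones ([] ∷ []) ()
column-of-ones ([] ∷ _ ∷ _) ()
column-of-ones ((x ∷ []) ∷ rows) partition with leg , refl ← column-of-ones rows partition = x ∷ leg , refl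

hook-shape : ∀ t → isPartitionᵇ (shape t) ≡ true → IsHook (shape t) → 0 < sum (shape t)
  → ∃[ a ] ∃[ arm ] ∃[ leg ] t ≡ hook a arm leg
hook-shape ([] ∷ []) ()
hook-shape ([] ∷ _ ∷ _) ()
hook-shape ((a ∷ arm) ∷ []) _ _ _ = a , arm , [] , refl
hook-shape ((a ∷ arm) ∷ [] ∷ []) ()
hook-shape ((a ∷ arm) ∷ [] ∷ _ ∷ _) ()
hook-shape ((a ∷ arm) ∷ (x ∷ []) ∷ rows) partition _ _
  with leg , refl ← column-of-ones rows (isPartitionᵇ-tail {length (a ∷ arm)} {1} {map length rows} partition)
  = a , arm , x ∷ leg , refl
hook-shape ((a ∷ arm) ∷ (_ ∷ _ ∷ _) ∷ _) _ (s≤s (s≤s ()))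

module HookEntries {n a arm leg}
  (len : length ((a ∷ arm) ++ leg) ≡ n) (once : OccursOnce n ((a ∷ arm) ++ leg))
  (inc : isIncreasingᵇ (hook a arm leg) ≡ true) where

  private
    inc-both : rowIncᵇ (a ∷ arm) ∧ rowIncᵇ (a ∷ leg) ≡ true
    inc-both = trans (sym (isIncreasingᵇ-hook a arm leg)) inc

    once-each : 1 ≤ k → k ≤ n → length (filter (_≟ k) ((a ∷ arm) ++ leg)) ≡ 1
    once-each = occurs-once {es = (a ∷ arm) ++ leg} once

  arm↑ : Increasing (a ∷ arm)
  arm↑ = rowIncᵇ-sound (∧-≡true-proj₁ inc-both)

  leg↑ : Increasing (a ∷ leg)
  leg↑ = rowIncᵇ-sound (∧-≡true-proj₂ inc-both)

  covers : 1 ≤ k → k ≤ n → k ∈ a ∷ arm ⊎ k ∈ leg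
  covers 1≤k k≤n = ∈-++⁻ (a ∷ arm) (occurs⇒∈ _ (≤-reflexive (sym (once-each 1≤k k≤n))))

  disjoint : 1 ≤ k → k ≤ n → k ∈ arm → k ∉ leg
  disjoint 1≤k k≤n k∈arm k∈leg =
    <-irrefl refl (subst (2 ≤_) (once-each 1≤k k≤n) (∈-both⇒occurs-twice {xs = a ∷ arm} (there k∈arm) k∈leg))

  -- a = 0 would put the n + 1 distinct values 0, …, n into n boxes.
  corner≡1 : 1 ≤ n → a ≡ 1
  corner≡1 1≤n = ≤-antisym a≤1 (n≢0⇒n>0 a≢0)
    where
    a≤1 : a ≤ 1
    a≤1 with covers ≤-refl 1≤n
    ... | inj₁ 1∈a∷arm = head≤ arm↑ 1∈a∷arm
    ... | inj₂ 1∈leg = <⇒≤ (head<tail leg↑ 1∈leg)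
    a≢0 : a ≢ 0
    a≢0 refl = <-irrefl (sym len) (contains-upTo⇒<length n contains)
      where
      contains : ∀ {k} → k ≤ n → k ∈ (0 ∷ arm) ++ leg
      contains {zero} _ = here refl
      contains {suc k} k<n with covers (s≤s z≤n) k<n
      ... | inj₁ k∈a∷arm = ∈-++⁺ˡ k∈a∷arm
      ... | inj₂ k∈leg = ∈-++⁺ʳ (0 ∷ arm) k∈leg

concat-hook : ∀ a arm leg → concat (hook a arm leg) ≡ (a ∷ arm) ++ leg
concat-hook a arm leg = cong ((a ∷ arm) ++_) concat-map-[ leg ]

IsSYT⇒HookSYT : ∀ {la t} → IsHook la → IsSYT (suc n) la t → HookSYT (suc n) t
IsSYT⇒HookSYT {n} {t = t} hook-la ((partition , sum≡1+n) , refl , len , once , inc)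
  with a , arm , leg , refl ← hook-shape t partition hook-la (subst (0 <_) (sym sum≡1+n) (s≤s z≤n))
  with len′ ← trans (cong length (sym (concat-hook a arm leg))) len
     | once′ ← subst (OccursOnce (suc n)) (concat-hook a arm leg) once
  with refl ← HookEntries.corner≡1 {a = a} {arm} {leg} len′ once′ inc (s≤s z≤n)
  = hookSYT (record { arm↑ = arm↑ ; leg↑ = leg↑ ; covers = covers ; disjoint = disjoint })
  where open HookEntries {a = 1} {arm} {leg} len′ once′ inc

mainTheorem5 : (n : ℕ) (λ₁ λ₂ : List ℕ) (A B : List (List ℕ))
    → IsHook λ₁ → IsHook λ₂
    → IsSYT n λ₁ A → IsSYT n λ₂ B
    → (g : List (ℕ × ℕ)) → ValidWord n g
    → length (S n (act g A) (act g B)) ≡ length (S n A B)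
mainTheorem5 zero _ _ _ _ _ _ _ _ _ _ = refl
mainTheorem5 (suc n) λ₁ λ₂ A B hook₁ hook₂ syt₁ syt₂ g valid =
  length-S-relabelled {A = A} {act g A} {B} {act g B} count-π
    (proj₂ (relabels (IsSYT⇒HookSYT hook₁ syt₁))) (proj₂ (relabels (IsSYT⇒HookSYT hook₂ syt₂)))
  where open PermutesFirstRows (act-permutes g valid)
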